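{- There is no connected ordered $\lambda$-model with more than one element that satisfies both equations $\Theta x x = \Omega$ and $\Theta x\Omega = x$.
   Context: $\Omega \equiv (\lambda x.xx)(\lambda x.xx)$, $B \equiv \lambda x.x(\lambda y.yx)$, $C \equiv \lambda z.zB$, $\Theta \equiv BC$. A combinatory algebra is a structure $(A,\cdot,K,S)$ with a binary application satisfying $Kxy=x$, $Sxyz=xz(yz)$. With $I\equiv SKK$, $\varepsilon\equiv\varepsilon_1 \equiv S(KI)$, $\varepsilon_{n+1}\equiv S(K\varepsilon)(S(K\varepsilon_n))$, a $\lambda$-model is a combinatory algebra satisfying $\forall xy((\forall z.\ xz=yz)\Rightarrow\varepsilon x=\varepsilon y)$, $\varepsilon_2K=K$, $\varepsilon_3S=S$; $\lambda$-terms are interpreted in the standard way and an equation holds if both sides have equal interpretation in every environment. An ordered $\lambda$-model is a $\lambda$-model with a partial order $\le$ making application monotone in both arguments. It is connected if the least equivalence relation containing $\le$ has a single equivalence class. -}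

module Defs where

open import Level using (Level; _⊔_) renaming (suc to lsuc)
open import Data.Nat using (ℕ; zero) renaming (suc to sucℕ)
open import Data.Fin using (Fin; zero; suc)
open import Data.Maybe using (Maybe; just; nothing)
open import Data.Product using (Σ; ∃; _×_; _,_)
open import Relation.Binary.PropositionalEquality using (_≡_; _≢_)
open import Relation.Binary.Core using (Rel)
open import Relation.Binary.Structures using (IsPartialOrder)
open import Relation.Binary.Construct.Closure.Equivalence using (EqClosure)

record CombinatoryAlgebra (ℓ : Level) : Set (lsuc ℓ) where
  infixl 9 _·_
  field
    Carrier : Set ℓ
    _·_     : Carrier → Carrier → Carrier
    K S     : Carrier
    K-law   : ∀ x y → K · x · y ≡ x
    S-law   : ∀ x y z → S · x · y · z ≡ x · z · (y · z)

  I : Carrier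
  I = S · K · K

  -- ε ≡ ε₁ ≡ S(KI),  ε_{n+1} ≡ S(Kε)(S(Kε_n));  eps n is ε_{n+1}
  eps : ℕ → Carrier
  eps ℕ.zero     = S · (K · I)
  eps (sucℕ n)   = S · (K · eps 0) · (S · (K · eps n))

  ε₁ ε₂ ε₃ : Carrier
  ε₁ = eps 0
  ε₂ = eps 1
  ε₃ = eps 2

record LambdaModel (ℓ : Level) : Set (lsuc ℓ) where
  field
    ca : CombinatoryAlgebra ℓ
  open CombinatoryAlgebra ca public
  field
    weak-ext : ∀ x y → (∀ z → x · z ≡ y · z) → ε₁ · x ≡ ε₁ · y
    ε₂K      : ε₂ · K ≡ K
    ε₃S      : ε₃ · S ≡ S

record OrderedLambdaModel (ℓ ℓ' : Level) : Set (lsuc (ℓ ⊔ ℓ')) where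
  field
    lm : LambdaModel ℓ
  open LambdaModel lm public
  field
    _≤_            : Rel Carrier ℓ'
    isPartialOrder : IsPartialOrder _≡_ _≤_
    ·-mono         : ∀ {x x' y y'} → x ≤ x' → y ≤ y' → (x · y) ≤ (x' · y')

Connected : ∀ {ℓ ℓ'} → OrderedLambdaModel ℓ ℓ' → Set (ℓ ⊔ ℓ')
Connected M = ∀ a b → EqClosure _≤_ a b
  where open OrderedLambdaModel M

Nontrivial : ∀ {ℓ ℓ'} → OrderedLambdaModel ℓ ℓ' → Set ℓ
Nontrivial M = Σ Carrier λ a → Σ Carrier λ b → a ≢ b
  where open OrderedLambdaModel M

data Λ (n : ℕ) : Set where
  var : Fin n → Λ n
  app : Λ n → Λ n → Λ n
  lam : Λ (sucℕ n) → Λ n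

data CL (n : ℕ) : Set where
  var : Fin n → CL n
  app : CL n → CL n → CL n
  Kc Sc : CL n

Ic : ∀ {n} → CL n
Ic = app (app Sc Kc) Kc

strengthen : ∀ {n} → CL (sucℕ n) → Maybe (CL n)
strengthen (var zero)    = nothing
strengthen (var (suc i)) = just (var i)
strengthen (app P Q) with strengthen P | strengthen Q
... | just P' | just Q' = just (app P' Q')
... | _       | _       = nothing
strengthen Kc = just Kc
strengthen Sc = just Sc

-- bracket abstraction λ*x (Barendregt): λ*x.x = I, λ*x.P = KP if x ∉ FV(P),
-- λ*x.PQ = S(λ*x.P)(λ*x.Q)
abstr : ∀ {n} → CL (sucℕ n) → CL n
abstr t with strengthen t
abstr t         | just t' = app Kc t'
abstr (var zero)    | nothing = Ic
abstr (var (suc i)) | nothing = app Kc (var i)   -- unreachable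
abstr (app P Q) | nothing = app (app Sc (abstr P)) (abstr Q)
abstr Kc        | nothing = app Kc Kc             -- unreachable
abstr Sc        | nothing = app Kc Sc             -- unreachable

toCL : ∀ {n} → Λ n → CL n
toCL (var i)   = var i
toCL (app M N) = app (toCL M) (toCL N)
toCL (lam M)   = abstr (toCL M)

module _ {ℓ} (M : LambdaModel ℓ) where
  open LambdaModel M

  ⟦_⟧CL_ : ∀ {n} → CL n → (Fin n → Carrier) → Carrier
  ⟦ var i ⟧CL ρ   = ρ i
  ⟦ app P Q ⟧CL ρ = (⟦ P ⟧CL ρ) · (⟦ Q ⟧CL ρ)
  ⟦ Kc ⟧CL ρ      = K
  ⟦ Sc ⟧CL ρ      = S

  ⟦_⟧_ : ∀ {n} → Λ n → (Fin n → Carrier) → Carrier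
  ⟦ t ⟧ ρ = ⟦ toCL t ⟧CL ρ

  Holds : ∀ {n} → Λ n → Λ n → Set ℓ
  Holds t u = ∀ ρ → ⟦ t ⟧ ρ ≡ ⟦ u ⟧ ρ

Ωt : ∀ {n} → Λ n            -- (λx.xx)(λx.xx)
Ωt = app (lam (app (var zero) (var zero))) (lam (app (var zero) (var zero)))

Bt : ∀ {n} → Λ n            -- λx.x(λy.yx)
Bt = lam (app (var zero) (lam (app (var zero) (var (suc zero)))))

Ct : ∀ {n} → Λ n            -- λz.zB
Ct = lam (app (var zero) Bt)

Θt : ∀ {n} → Λ n
Θt = app Bt Ct

xt : Λ 1
xt = var zero

module Submission where

-- Write T and ω for the (closed, hence environment-free)
-- interpretations of Θ and Ω.  The two equations say T·a·a = ω and T·a·ω = a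
-- for every element a.  Monotonicity of application then forces ω to be an
-- isolated point of the order: if a ≤ ω then ω = T·a·a ≤ T·a·ω = a, and if
-- ω ≤ a then a = T·a·ω ≤ T·a·a = ω, so a = ω by antisymmetry either way.
-- An isolated point is a whole class of the equivalence closure of ≤, so in a
-- connected model every element equals ω, contradicting nontriviality.

open import Defs
open import Level using (Level; _⊔_)
open import Relation.Nullary using (¬_)
open import Data.Product using (_×_; _,_)
open import Data.Fin using (Fin)
open import Relation.Binary.Core using (Rel)
open import Relation.Binary.Bundles using (Poset)
open import Relation.Binary.Structures using (IsPartialOrder)
open import Relation.Binary.PropositionalEquality using (_≡_; refl; sym; trans)
open import Relation.Binary.Construct.Closure.Equivalence using (EqClosure)
open import Relation.Binary.Construct.Closure.ReflexiveTransitive using (ε; _◅_)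
open import Relation.Binary.Construct.Closure.Symmetric using (SymClosure; fwd; bwd)
import Relation.Binary.Reasoning.PartialOrder as PosetReasoning

module _ {a ℓ : Level} {A : Set a} (R : Rel A ℓ) where

  Isolated : A → Set (a ⊔ ℓ)
  Isolated ω = ∀ {x} → SymClosure R ω x → x ≡ ω

  -- The equivalence class of an isolated point under EqClosure R is {ω}:
  -- each step of a zig-zag path that starts at ω stays at ω.
  isolated-class : ∀ {ω x} → Isolated ω → EqClosure R ω x → x ≡ ω
  isolated-class isolated ε             = refl
  isolated-class isolated (step ◅ path) with isolated step
  ... | refl = isolated-class isolated path

  isolated-connected-trivial : ∀ {ω} → (∀ x y → EqClosure R x y) →
                               Isolated ω → ∀ x y → x ≡ y
  isolated-connected-trivial {ω} connected isolated x y =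
    trans (isolated-class isolated (connected ω x))
          (sym (isolated-class isolated (connected ω y)))

module _ {ℓ ℓ'} (M : OrderedLambdaModel ℓ ℓ') where
  open OrderedLambdaModel M
  open IsPartialOrder isPartialOrder using (antisym) renaming (refl to ≤-refl)

  poset : Poset ℓ ℓ ℓ'
  poset = record { isPartialOrder = isPartialOrder }

  open PosetReasoning poset

  -- If T·a·a = ω and T·a·ω = a for all a, then ω is comparable only with
  -- itself: monotonicity of T·a transports a ≤ ω to ω ≤ a and vice versa.
  separating-point-isolated : (T ω : Carrier) →
                              (∀ a → T · a · a ≡ ω) → (∀ a → T · a · ω ≡ a) →
                              Isolated _≤_ ω
  separating-point-isolated T ω Taa Taω {a} (fwd ω≤a) = antisym
    (begin
      a         ≡⟨ Taω a ⟨
      T · a · ω ≤⟨ ·-mono ≤-refl ω≤a ⟩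
      T · a · a ≡⟨ Taa a ⟩
      ω         ∎)
    ω≤a
  separating-point-isolated T ω Taa Taω {a} (bwd a≤ω) = antisym
    a≤ω
    (begin
      ω         ≡⟨ Taa a ⟨
      T · a · a ≤⟨ ·-mono ≤-refl a≤ω ⟩
      T · a · ω ≡⟨ Taω a ⟩
      a         ∎)

-- Θ and Ω are closed terms, so their interpretations do not depend on the
-- environment; the constant environment at a turns the two equations into
-- T·a·a = ω and T·a·ω = a.
theorem3p3 : ∀ {ℓ ℓ'} (M : OrderedLambdaModel ℓ ℓ') →
    Connected M → Nontrivial M →
    ¬ (Holds (OrderedLambdaModel.lm M) (app (app Θt xt) xt) Ωt
       × Holds (OrderedLambdaModel.lm M) (app (app Θt xt) Ωt) xt)
theorem3p3 M connected (a , b , a≢b) (ΘxxΩ , ΘxΩx) =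
  a≢b (isolated-connected-trivial _≤_ connected ω-isolated a b)
  where
    open OrderedLambdaModel M

    constant : Carrier → Fin 1 → Carrier
    constant c _ = c

    T ω : Carrier
    T = ⟦_⟧_ lm (Θt {0}) (λ ())
    ω = ⟦_⟧_ lm (Ωt {0}) (λ ())

    ω-isolated : Isolated _≤_ ω
    ω-isolated = separating-point-isolated M T ω
      (λ c → ΘxxΩ (constant c)) (λ c → ΘxΩx (constant c))
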